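{- There are infinitely many (pairwise non-isomorphic) connected graphs $G$ of minimum degree $2$ such that $\operatorname{fdom}(G)\le 5/2$.
   Context: For integers $0<q\le p$, a dominating $(p:q)$-colouring of a graph $G$ is a map $\phi\colon V(G)\to\binom{[p]}{q}$ with $\bigcup_{u\in N[v]}\phi(u)=[p]$ for every vertex $v$ ($N[v]$ the closed neighbourhood); $\operatorname{fdom}(G)$ is the maximum of $p/q$ over such colourings. -}

module Defs where

open import Data.Nat using (ℕ; zero; suc; _+_; _*_; _≤_; _<_)
open import Data.Bool using (Bool; true; false; if_then_else_)
open import Data.Fin using (Fin)
open import Data.Fin.Subset using (Subset; _∈_; ∣_∣)
open import Data.List using (List; map; allFin)
open import Data.Nat.ListAction using (sum)
open import Data.Product using (Σ; ∃; _×_; _,_)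
open import Data.Sum using (_⊎_)
open import Relation.Binary.PropositionalEquality using (_≡_)
open import Relation.Nullary using (¬_)
open import Function.Bundles using (_↔_; Inverse)

record Graph (n : ℕ) : Set where
  field
    adj   : Fin n → Fin n → Bool
    sym   : ∀ u v → adj u v ≡ adj v u
    irrefl : ∀ v → adj v v ≡ false
open Graph public

deg : ∀ {n} → Graph n → Fin n → ℕ
deg {n} G v = sum (map (λ u → if adj G v u then 1 else 0) (allFin n))

MinDegree : ∀ {n} → Graph n → ℕ → Set
MinDegree {n} G d = (∀ v → d ≤ deg G v) × ∃ λ (v : Fin n) → deg G v ≡ d

data Walk {n} (G : Graph n) : Fin n → Fin n → Set where
  here : ∀ {v} → Walk G v v
  step : ∀ {u v w} → adj G u v ≡ true → Walk G v w → Walk G u w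

Connected : ∀ {n} → Graph n → Set
Connected G = ∀ u v → Walk G u v

InClosedNbhd : ∀ {n} → Graph n → Fin n → Fin n → Set
InClosedNbhd G v u = (u ≡ v) ⊎ (adj G v u ≡ true)

record DomColouring {n} (G : Graph n) (p q : ℕ) : Set where
  field
    φ      : Fin n → Subset p
    size   : ∀ v → ∣ φ v ∣ ≡ q
    covers : ∀ v (c : Fin p) → ∃ λ u → InClosedNbhd G v u × (c ∈ φ u)

-- fdom(G) ≤ a/b  (b > 0): every dominating (p:q)-colouring with
-- 0 < q ≤ p has p/q ≤ a/b, i.e. p * b ≤ a * q.
FdomAtMost : ∀ {n} → Graph n → ℕ → ℕ → Set
FdomAtMost G a b = ∀ p q → 0 < q → q ≤ p → DomColouring G p q → p * b ≤ a * q

Iso : ∀ {n m} → Graph n → Graph m → Set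
Iso {n} {m} G H = Σ (Fin n ↔ Fin m) λ f →
  ∀ u v → adj H (Inverse.to f u) (Inverse.to f v) ≡ adj G u v

SomeGraph : Set
SomeGraph = Σ ℕ Graph

IsoSome : SomeGraph → SomeGraph → Set
IsoSome (_ , G) (_ , H) = Iso G H

module Submission where

open import Defs hiding (sym)
open import Algebra.Properties.CommutativeSemigroup using (x∙yz≈y∙xz)
open import Data.Bool using (Bool; true; false; _∧_; _∨_; if_then_else_)
open import Data.Bool.Properties using (∨-comm)
open import Data.Fin using (Fin; zero; suc; #_; toℕ; inject₁; fromℕ; _↑ʳ_)
open import Data.Fin.Induction using (<-weakInduction)
open import Data.Fin.Permutation using (↔⇒≡)
open import Data.Fin.Properties using (toℕ-inject₁; toℕ-fromℕ)
open import Data.Fin.Relation.Unary.Top using (view; ‵fromℕ; ‵inject₁)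
open import Data.Fin.Subset using (Subset; inside; outside; ∣_∣) renaming (_∈_ to _∈ˢ_)
open import Data.Fin.Subset.Properties using (_∈?_; anySubset?)
open import Data.List using (tabulate)
open import Data.List.Properties using (map-tabulate)
open import Data.Nat using (ℕ; zero; suc; _+_; _*_; _≤_; _<_; _<?_; _≡ᵇ_; z≤n)
open import Data.Nat.ListAction using (sum)
open import Data.Nat.Properties
  using (+-commutativeSemigroup; ≤-trans; ≮⇒≥; +-mono-≤; +-monoʳ-≤; m≤m+n; m≤n+m; +-comm; +-cancelˡ-≡;
         m≢1+n+m; module ≤-Reasoning)
open import Data.Product using (Σ; _×_; _,_; proj₂)
open import Data.Sum using (_⊎_; inj₁; inj₂) renaming (map to map⊎)
open import Data.Vec using (Vec; []; _∷_; lookup; map; tail)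
open import Data.Vec.Properties using (lookup-map; []=⇒lookup; lookup⇒[]=)
open import Function using (_∘_)
open import Relation.Binary.PropositionalEquality using (_≡_; _≢_; refl; sym; trans; cong; cong₂; subst)
open import Relation.Nullary using (¬_; Dec; contradiction)
open import Relation.Nullary.Decidable using (_×-dec_; _⊎-dec_; from-no)
open import Relation.Unary using (Decidable)

-- Glue a 5-cycle v₀ v₁ v₂ v₃ v₄ at v₀ to a cycle of length i + 3.  The closed neighbourhoods of
-- v₁, …, v₄ are the windows {v₀,v₁,v₂}, {v₁,v₂,v₃}, {v₂,v₃,v₄}, {v₃,v₄,v₀} of the 5-cycle, and a
-- dominating colouring must give every colour to a vertex of each window.  Any set of vertices of
-- the 5-cycle meeting all four windows has at least two elements, so double counting the pairs
-- (vertex, colour) on the 5-cycle gives 2p ≤ 5q.  The graphs have pairwise different orders.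

≡ᵇ-refl : ∀ m → (m ≡ᵇ m) ≡ true
≡ᵇ-refl zero    = refl
≡ᵇ-refl (suc m) = ≡ᵇ-refl m

1+m≢ᵇm : ∀ m → (suc m ≡ᵇ m) ≡ false
1+m≢ᵇm zero    = refl
1+m≢ᵇm (suc m) = 1+m≢ᵇm m

module _ {n} {G : Graph n} where

  infixr 5 _◅◅_

  _◅◅_ : ∀ {u v w} → Walk G u v → Walk G v w → Walk G u w
  here     ◅◅ q = q
  step e p ◅◅ q = step e (p ◅◅ q)

  reverse : ∀ {u v} → Walk G u v → Walk G v u
  reverse here               = here
  reverse (step {u} {v} e p) = reverse p ◅◅ step (trans (Graph.sym G v u) e) here

ConsecutiveAdjacent : ∀ {n} → Graph (suc n) → Set
ConsecutiveAdjacent {n} G = ∀ (k : Fin n) → adj G (inject₁ k) (suc k) ≡ true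

consecutiveAdjacent-sym : ∀ {n} {G : Graph (suc n)} → ConsecutiveAdjacent G →
  ∀ k → adj G (suc k) (inject₁ k) ≡ true
consecutiveAdjacent-sym {G = G} path k = trans (Graph.sym G (suc k) (inject₁ k)) (path k)

consecutiveAdjacent⇒connected : ∀ {n} {G : Graph (suc n)} → ConsecutiveAdjacent G → Connected G
consecutiveAdjacent⇒connected {G = G} path u v = reverse (fromZero u) ◅◅ fromZero v
  where
  fromZero : ∀ v → Walk G zero v
  fromZero = <-weakInduction (Walk G zero) here (λ k w → w ◅◅ step (path k) here)

≤-sum-tabulate : ∀ {n} (f : Fin n → ℕ) a → f a ≤ sum (tabulate f)
≤-sum-tabulate f zero    = m≤m+n _ _
≤-sum-tabulate f (suc a) = ≤-trans (≤-sum-tabulate (f ∘ suc) a) (m≤n+m _ _)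

+-≤-sum-tabulate : ∀ {n} (f : Fin n → ℕ) {a b} → a ≢ b → f a + f b ≤ sum (tabulate f)
+-≤-sum-tabulate f {zero}  {zero}  a≢b = contradiction refl a≢b
+-≤-sum-tabulate f {zero}  {suc b} _   = +-monoʳ-≤ (f zero) (≤-sum-tabulate (f ∘ suc) b)
+-≤-sum-tabulate f {suc a} {zero}  _   =
  subst (_≤ sum (tabulate f)) (+-comm (f zero) (f (suc a)))
    (+-monoʳ-≤ (f zero) (≤-sum-tabulate (f ∘ suc) a))
+-≤-sum-tabulate f {suc a} {suc b} a≢b =
  ≤-trans (+-≤-sum-tabulate (f ∘ suc) (a≢b ∘ cong suc)) (m≤n+m _ _)

sum-tabulate-0 : ∀ {n} (f : Fin n → ℕ) → (∀ k → f k ≡ 0) → sum (tabulate f) ≡ 0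
sum-tabulate-0 {zero}  f f≡0 = refl
sum-tabulate-0 {suc n} f f≡0 = cong₂ _+_ (f≡0 zero) (sum-tabulate-0 (f ∘ suc) (f≡0 ∘ suc))

adjacency : ∀ {n} → Graph n → Fin n → Fin n → ℕ
adjacency G v u = if adj G v u then 1 else 0

deg≡sum-tabulate : ∀ {n} (G : Graph n) v → deg G v ≡ sum (tabulate (adjacency G v))
deg≡sum-tabulate G v = cong sum (map-tabulate (λ u → u) (adjacency G v))

two-neighbours⇒2≤deg : ∀ {n} {G : Graph n} {v a b} → a ≢ b →
  adj G v a ≡ true → adj G v b ≡ true → 2 ≤ deg G v
two-neighbours⇒2≤deg {G = G} {v} a≢b va vb =
  subst (_≤ deg G v) (cong₂ (λ x y → (if x then 1 else 0) + (if y then 1 else 0)) va vb)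
    (subst (_ ≤_) (sym (deg≡sum-tabulate G v)) (+-≤-sum-tabulate (adjacency G v) a≢b))

interior-2≤deg : ∀ {n} {G : Graph (suc (suc n))} → ConsecutiveAdjacent G →
  ∀ k → 2 ≤ deg G (suc (inject₁ k))
interior-2≤deg {G = G} path k =
  two-neighbours⇒2≤deg {G = G} apart (consecutiveAdjacent-sym {G = G} path (inject₁ k)) (path (suc k))
  where
  apart : inject₁ (inject₁ k) ≢ suc (suc k)
  apart eq = m≢1+n+m (toℕ k) {1}
    (trans (sym (trans (toℕ-inject₁ (inject₁ k)) (toℕ-inject₁ k))) (cong toℕ eq))

holders : ∀ {m p} → Vec (Subset p) m → Fin p → Subset m
holders xs c = map (λ x → lookup x c) xs

sumSizes : ∀ {m p} → Vec (Subset p) m → ℕ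
sumSizes []       = 0
sumSizes (x ∷ xs) = ∣ x ∣ + sumSizes xs

∈⇒∈-holders : ∀ {m p} (xs : Vec (Subset p) m) j {c} → c ∈ˢ lookup xs j → j ∈ˢ holders xs c
∈⇒∈-holders xs j c∈ = lookup⇒[]= j _ (trans (lookup-map j _ xs) ([]=⇒lookup c∈))

holders-map-tail : ∀ {m p} (xs : Vec (Subset (suc p)) m) c → holders (map tail xs) c ≡ holders xs (suc c)
holders-map-tail []             c = refl
holders-map-tail ((_ ∷ _) ∷ xs) c = cong (_ ∷_) (holders-map-tail xs c)

sumSizes-∷ : ∀ {m p} (x : Subset p) (xs : Vec (Subset (suc p)) m) →
  ∣ x ∣ + sumSizes xs ≡ ∣ holders xs zero ∣ + (∣ x ∣ + sumSizes (map tail xs))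

sumSizes-split : ∀ {m p} (xs : Vec (Subset (suc p)) m) →
  sumSizes xs ≡ ∣ holders xs zero ∣ + sumSizes (map tail xs)
sumSizes-split []                   = refl
sumSizes-split ((inside ∷ x) ∷ xs)  = cong suc (sumSizes-∷ x xs)
sumSizes-split ((outside ∷ x) ∷ xs) = sumSizes-∷ x xs

sumSizes-∷ x xs = trans (cong (∣ x ∣ +_) (sumSizes-split xs))
  (x∙yz≈y∙xz +-commutativeSemigroup ∣ x ∣ ∣ holders xs zero ∣ (sumSizes (map tail xs)))

p*k≤sumSizes : ∀ {m p k} (xs : Vec (Subset p) m) → (∀ c → k ≤ ∣ holders xs c ∣) → p * k ≤ sumSizes xs
p*k≤sumSizes {p = zero}      xs k≤ = z≤n
p*k≤sumSizes {p = suc p} {k} xs k≤ = begin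
  k + p * k                                     ≤⟨ +-mono-≤ (k≤ zero) (p*k≤sumSizes (map tail xs) k≤′) ⟩
  ∣ holders xs zero ∣ + sumSizes (map tail xs)  ≡⟨ sumSizes-split xs ⟨
  sumSizes xs                                   ∎
  where
  open ≤-Reasoning
  k≤′ : ∀ c → k ≤ ∣ holders (map tail xs) c ∣
  k≤′ c = subst (λ s → k ≤ ∣ s ∣) (sym (holders-map-tail xs c)) (k≤ (suc c))

MeetsOneOf : ∀ {n} → Subset n → Fin n → Fin n → Fin n → Set
MeetsOneOf s a b c = a ∈ˢ s ⊎ b ∈ˢ s ⊎ c ∈ˢ s

MeetsFiveCycleWindows : Subset 5 → Set
MeetsFiveCycleWindows s = MeetsOneOf s (# 0) (# 1) (# 2) × MeetsOneOf s (# 1) (# 2) (# 3)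
                        × MeetsOneOf s (# 2) (# 3) (# 4) × MeetsOneOf s (# 3) (# 4) (# 0)

∈⇒meetsOneOf-holders : ∀ {m p} (xs : Vec (Subset p) m) i j k {c} →
  c ∈ˢ lookup xs i ⊎ c ∈ˢ lookup xs j ⊎ c ∈ˢ lookup xs k → MeetsOneOf (holders xs c) i j k
∈⇒meetsOneOf-holders xs i j k =
  map⊎ (∈⇒∈-holders xs i) (map⊎ (∈⇒∈-holders xs j) (∈⇒∈-holders xs k))

-- An exhaustive check: the decision procedure is evaluated over all 32 subsets of Fin 5.
meetsFiveCycleWindows⇒2≤∣∣ : ∀ s → MeetsFiveCycleWindows s → 2 ≤ ∣ s ∣
meetsFiveCycleWindows⇒2≤∣∣ s meets =
  ≮⇒≥ λ small → from-no (anySubset? counterexample?) (s , meets , small)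
  where
  meetsOneOf? : ∀ s a b c → Dec (MeetsOneOf s a b c)
  meetsOneOf? s a b c = a ∈? s ⊎-dec b ∈? s ⊎-dec c ∈? s
  counterexample? : Decidable (λ s → MeetsFiveCycleWindows s × ∣ s ∣ < 2)
  counterexample? s = (meetsOneOf? s (# 0) (# 1) (# 2) ×-dec meetsOneOf? s (# 1) (# 2) (# 3)
                    ×-dec meetsOneOf? s (# 2) (# 3) (# 4) ×-dec meetsOneOf? s (# 3) (# 4) (# 0))
                    ×-dec (∣ s ∣ <? 2)

NeighboursWithin : ∀ {n} → Graph n → Fin n → Fin n → Fin n → Set
NeighboursWithin G v a b = ∀ {u} → adj G v u ≡ true → u ≡ a ⊎ u ≡ b

module _ {n} {G : Graph n} {p q} (col : DomColouring G p q) where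
  open DomColouring col

  colour-near : ∀ {v a b} → NeighboursWithin G v a b → ∀ c → c ∈ˢ φ a ⊎ c ∈ˢ φ v ⊎ c ∈ˢ φ b
  colour-near within c with covers _ c
  ... | u , inj₁ refl , c∈ = inj₂ (inj₁ c∈)
  ... | u , inj₂ vu , c∈ with within vu
  ...   | inj₁ refl = inj₁ c∈
  ...   | inj₂ refl = inj₂ (inj₂ c∈)

  sumSizes-map-φ : ∀ {m} (vs : Vec (Fin n) m) → sumSizes (map φ vs) ≡ m * q
  sumSizes-map-φ []       = refl
  sumSizes-map-φ (v ∷ vs) = cong₂ _+_ (size v) (sumSizes-map-φ vs)

pendantFiveCycle⇒fdom≤5/2 : ∀ {n} {G : Graph n} {v₀ v₁ v₂ v₃ v₄} →
  NeighboursWithin G v₁ v₀ v₂ → NeighboursWithin G v₂ v₁ v₃ →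
  NeighboursWithin G v₃ v₂ v₄ → NeighboursWithin G v₄ v₃ v₀ → FdomAtMost G 5 2
pendantFiveCycle⇒fdom≤5/2 {v₀ = v₀} {v₁} {v₂} {v₃} {v₄} w₁ w₂ w₃ w₄ p q _ _ col =
  subst (p * 2 ≤_) (sumSizes-map-φ col vs)
    (p*k≤sumSizes (map φ vs) (λ c → meetsFiveCycleWindows⇒2≤∣∣ _ (meets c)))
  where
  open DomColouring col
  vs : Vec _ 5
  vs = v₀ ∷ v₁ ∷ v₂ ∷ v₃ ∷ v₄ ∷ []
  meets : ∀ c → MeetsFiveCycleWindows (holders (map φ vs) c)
  meets c = ∈⇒meetsOneOf-holders (map φ vs) (# 0) (# 1) (# 2) (colour-near col w₁ c)
          , ∈⇒meetsOneOf-holders (map φ vs) (# 1) (# 2) (# 3) (colour-near col w₂ c)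
          , ∈⇒meetsOneOf-holders (map φ vs) (# 2) (# 3) (# 4) (colour-near col w₃ c)
          , ∈⇒meetsOneOf-holders (map φ vs) (# 3) (# 4) (# 0) (colour-near col w₄ c)

undirected : ∀ {n} (R : Fin n → Fin n → Bool) → (∀ v → R v v ≡ false) → Graph n
undirected R R-irrefl = record
  { adj    = λ u v → R u v ∨ R v u
  ; sym    = λ u v → ∨-comm (R u v) (R v u)
  ; irrefl = λ v → cong₂ _∨_ (R-irrefl v) (R-irrefl v)
  }

-- The path 0 – 1 – ⋯ – (6 + i) with the chords 0 – 4 and 4 – (6 + i): a 5-cycle and an
-- (i + 3)-cycle sharing the vertex 4.
arc : ℕ → ℕ → ℕ → Bool
arc i a b = (suc a ≡ᵇ b) ∨ ((a ≡ᵇ 0) ∧ (b ≡ᵇ 4)) ∨ ((a ≡ᵇ 4) ∧ (b ≡ᵇ 6 + i))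

arc-irrefl : ∀ i a → arc i a a ≡ false
arc-irrefl i 0 = refl
arc-irrefl i 1 = refl
arc-irrefl i 2 = refl
arc-irrefl i 3 = refl
arc-irrefl i 4 = refl
arc-irrefl i (suc (suc (suc (suc (suc a))))) rewrite 1+m≢ᵇm a = refl

twoCycles : ∀ i → Graph (7 + i)
twoCycles i = undirected (λ u v → arc i (toℕ u) (toℕ v)) (λ v → arc-irrefl i (toℕ v))

module _ (i : ℕ) where

  consecutive : ConsecutiveAdjacent (twoCycles i)
  consecutive k rewrite toℕ-inject₁ k | ≡ᵇ-refl (toℕ k) = refl

  neighbours-0 : NeighboursWithin (twoCycles i) (# 0) (# 4) (# 1)
  neighbours-0 {suc zero}                         _ = inj₂ refl
  neighbours-0 {suc (suc (suc (suc zero)))}       _ = inj₁ refl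
  neighbours-0 {zero}                             ()
  neighbours-0 {suc (suc zero)}                   ()
  neighbours-0 {suc (suc (suc zero))}             ()
  neighbours-0 {suc (suc (suc (suc (suc _))))}    ()

  neighbours-1 : NeighboursWithin (twoCycles i) (# 1) (# 0) (# 2)
  neighbours-1 {zero}                             _ = inj₁ refl
  neighbours-1 {suc (suc zero)}                   _ = inj₂ refl
  neighbours-1 {suc zero}                         ()
  neighbours-1 {suc (suc (suc zero))}             ()
  neighbours-1 {suc (suc (suc (suc zero)))}       ()
  neighbours-1 {suc (suc (suc (suc (suc _))))}    ()

  neighbours-2 : NeighboursWithin (twoCycles i) (# 2) (# 1) (# 3)
  neighbours-2 {suc zero}                         _ = inj₁ refl
  neighbours-2 {suc (suc (suc zero))}             _ = inj₂ refl
  neighbours-2 {zero}                             ()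
  neighbours-2 {suc (suc zero)}                   ()
  neighbours-2 {suc (suc (suc (suc zero)))}       ()
  neighbours-2 {suc (suc (suc (suc (suc _))))}    ()

  neighbours-3 : NeighboursWithin (twoCycles i) (# 3) (# 2) (# 4)
  neighbours-3 {suc (suc zero)}                   _ = inj₁ refl
  neighbours-3 {suc (suc (suc (suc zero)))}       _ = inj₂ refl
  neighbours-3 {zero}                             ()
  neighbours-3 {suc zero}                         ()
  neighbours-3 {suc (suc (suc zero))}             ()
  neighbours-3 {suc (suc (suc (suc (suc _))))}    ()

  last-adjacent-4 : adj (twoCycles i) (fromℕ (6 + i)) (# 4) ≡ true
  last-adjacent-4 rewrite toℕ-fromℕ i | ≡ᵇ-refl i = refl

  2≤deg : ∀ v → 2 ≤ deg (twoCycles i) v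
  2≤deg zero =
    two-neighbours⇒2≤deg {G = twoCycles i} {v = zero} {a = # 4} {b = # 1} (λ ()) refl refl
  2≤deg (suc w) with view w
  ... | ‵fromℕ     =
    two-neighbours⇒2≤deg {G = twoCycles i} {v = fromℕ (6 + i)} {a = inject₁ (fromℕ (5 + i))} {b = # 4}
      (λ ())
      (consecutiveAdjacent-sym {G = twoCycles i} consecutive (fromℕ (5 + i))) last-adjacent-4
  ... | ‵inject₁ k = interior-2≤deg {G = twoCycles i} consecutive k

  deg-0≡2 : deg (twoCycles i) zero ≡ 2
  deg-0≡2 = trans (deg≡sum-tabulate (twoCycles i) zero)
    (cong (2 +_) (sum-tabulate-0 (adjacency (twoCycles i) zero ∘ (7 ↑ʳ_)) (λ _ → refl)))

corollary13 : Σ (ℕ → SomeGraph) λ F →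
    (∀ i → Connected (proj₂ (F i)) × MinDegree (proj₂ (F i)) 2 × FdomAtMost (proj₂ (F i)) 5 2)
    × (∀ i j → ¬ (i ≡ j) → ¬ IsoSome (F i) (F j))
corollary13 = (λ i → 7 + i , twoCycles i) , properties , nonIsomorphic
  where
  properties : ∀ i → Connected (twoCycles i) × MinDegree (twoCycles i) 2 × FdomAtMost (twoCycles i) 5 2
  properties i = consecutiveAdjacent⇒connected {G = twoCycles i} (consecutive i)
               , (2≤deg i , zero , deg-0≡2 i)
               , pendantFiveCycle⇒fdom≤5/2 (neighbours-0 i) (neighbours-1 i) (neighbours-2 i) (neighbours-3 i)
  nonIsomorphic : ∀ i j → i ≢ j → ¬ Iso (twoCycles i) (twoCycles j)
  nonIsomorphic i j i≢j (f , _) = i≢j (+-cancelˡ-≡ 7 i j (↔⇒≡ f))
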